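{- Suppose $A$ is finite and let $a\in A$. The formula $\chi_{\mathsf{4}}:=\left(\bigwedge_{x\in A\setminus\{a\}}(\Box_x\bot\wedge\Box_a\Box_x\bot)\wedge\Box_a p\right)\to Cp$ belongs to $\mathsf{CK4}\cap\mathcal{L}_{alt}\mathcal{C}^p$ but not to $\mathsf{CK}\cap\mathcal{L}_{alt}\mathcal{C}^p$; in particular $\mathsf{CK4}\cap\mathcal{L}_{alt}\mathcal{C}^p\not\subseteq\mathsf{CK}\cap\mathcal{L}_{alt}\mathcal{C}^p$.
   Context: Fix a set $A$ of agents with $|A|\ge 2$ and a countably infinite set $\mathsf{Prop}$. $\mathcal{L}$: $\varphi::=p\mid\neg\varphi\mid(\varphi\wedge\varphi)\mid\Box_a\varphi$, with $\bot$ a contradiction. $\mathcal{C}$ extends this grammar with $C\varphi$ and $E\varphi$. On a Kripke model $\mathcal{M}=\langle W,\{R_a\}_{a\in A},V\rangle$: $\mathcal{M},u\models E\varphi$ iff $\varphi$ holds at every $v$ with $u(\bigcup_aR_a)v$; $\mathcal{M},u\models C\varphi$ iff $\varphi$ holds at every $v$ with $u(\bigcup_aR_a)^+v$ (transitive closure). For $\mathsf{L}\subseteq\mathcal{L}$, $\mathsf{CL}$ is the set of $\mathcal{C}$-formulas valid on all frames that validate $\mathsf{L}$. $\mathsf{K}$ is the minimal multi-agent normal modal logic (validated by all frames); $\mathsf{K4}$ adds $\Box_a\varphi\to\Box_a\Box_a\varphi$ for every $a$ (frames: all $R_a$ transitive). $\mathcal{L}_{ -a}$ ($a\in A$): by simultaneous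 induction the least set containing $\mathsf{Prop}$, every $\Box_x\psi$ with $x\neq a$, $\psi\in\mathcal{L}_{ -x}$, closed under $\neg,\wedge$; $\mathcal{L}_{alt}$: least set containing $\mathsf{Prop}\cup\bigcup_a\mathcal{L}_{ -a}$ closed under $\neg,\wedge$. $\mathcal{C}^p$ is the set of $\mathcal{C}$-formulas in which $C$ is the only modality occurring; $\mathcal{L}_{alt}\mathcal{C}^p$ is the set of Boolean combinations of formulas in $\mathcal{L}_{alt}$ and in $\mathcal{C}^p$. -}

module Defs where

open import Data.Nat using (ℕ)
open import Data.Fin using (Fin)
open import Data.List using (List; []; _∷_; foldr; filter)
open import Data.List using () renaming (allFin to allFinL)
open import Data.Product using (Σ; _×_; ∃-syntax)
open import Data.Empty using (⊥)
open import Relation.Nullary using (¬_; Dec; yes; no; ¬?)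

open import Relation.Binary.PropositionalEquality using (_≡_)
import Data.Fin as F

-- Agents: A = Fin n (finite; |A| ≥ 2 is assumed in the theorem).
-- Prop = ℕ (countably infinite set of propositional letters).

data Form (n : ℕ) : Set where
  var  : ℕ → Form n
  neg  : Form n → Form n
  and  : Form n → Form n → Form n
  box  : Fin n → Form n → Form n
  Ck   : Form n → Form n
  Ek   : Form n → Form n

module _ {n : ℕ} where

  _⇒_ : Form n → Form n → Form n
  φ ⇒ ψ = neg (and φ (neg ψ))

  botF : Form n
  botF = and (var 0) (neg (var 0))

  data IsL : Form n → Set where
    var : ∀ p → IsL (var p)
    neg : ∀ {φ} → IsL φ → IsL (neg φ)
    and : ∀ {φ ψ} → IsL φ → IsL ψ → IsL (and φ ψ)
    box : ∀ x {φ} → IsL φ → IsL (box x φ)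

  data Lminus (a : Fin n) : Form n → Set where
    var : ∀ p → Lminus a (var p)
    box : ∀ x {ψ} → ¬ (x ≡ a) → Lminus x ψ → Lminus a (box x ψ)
    neg : ∀ {φ} → Lminus a φ → Lminus a (neg φ)
    and : ∀ {φ ψ} → Lminus a φ → Lminus a ψ → Lminus a (and φ ψ)

  data Lalt : Form n → Set where
    var   : ∀ p → Lalt (var p)
    minus : ∀ a {φ} → Lminus a φ → Lalt φ
    neg   : ∀ {φ} → Lalt φ → Lalt (neg φ)
    and   : ∀ {φ ψ} → Lalt φ → Lalt ψ → Lalt (and φ ψ)

  data Cp : Form n → Set where
    var : ∀ p → Cp (var p)
    neg : ∀ {φ} → Cp φ → Cp (neg φ)
    and : ∀ {φ ψ} → Cp φ → Cp ψ → Cp (and φ ψ)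
    Ck  : ∀ {φ} → Cp φ → Cp (Ck φ)

  data LaltCp : Form n → Set where
    alt : ∀ {φ} → Lalt φ → LaltCp φ
    cp  : ∀ {φ} → Cp φ → LaltCp φ
    neg : ∀ {φ} → LaltCp φ → LaltCp (neg φ)
    and : ∀ {φ ψ} → LaltCp φ → LaltCp ψ → LaltCp (and φ ψ)

  record Frame : Set₁ where
    field
      W : Set
      R : Fin n → W → W → Set

  module _ (Fr : Frame) where
    open Frame Fr

    Rall : W → W → Set
    Rall u v = ∃[ x ] R x u v

    data Plus : W → W → Set where
      step : ∀ {u v} → Rall u v → Plus u v
      cons : ∀ {u v w} → Rall u v → Plus v w → Plus u w

    sat : (ℕ → W → Set) → Form n → W → Set
    sat V (var p)   u = V p u
    sat V (neg φ)   u = ¬ sat V φ u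
    sat V (and φ ψ) u = sat V φ u × sat V ψ u
    sat V (box x φ) u = ∀ v → R x u v → sat V φ v
    sat V (Ek φ)    u = ∀ v → Rall u v → sat V φ v
    sat V (Ck φ)    u = ∀ v → Plus u v → sat V φ v

    ValidOn : Form n → Set₁
    ValidOn φ = ∀ (V : ℕ → W → Set) (u : W) → sat V φ u

  -- A logic 𝖫 ⊆ 𝓛 is presented as the normal modal logic generated by a set
  -- of axioms Ax; a frame validates 𝖫 iff it validates every formula in Ax
  -- (validity on a frame is closed under MP, Nec, uniform substitution and
  -- contains 𝖪).
  Validates : Frame → (Form n → Set) → Set₁
  Validates Fr Ax = ∀ φ → Ax φ → ValidOn Fr φ

  CL : (Form n → Set) → Form n → Set₁
  CL Ax φ = ∀ (Fr : Frame) → Validates Fr Ax → ValidOn Fr φ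

  AxK : Form n → Set
  AxK _ = ⊥

  AxK4 : Form n → Set
  AxK4 φ = Σ (Fin n) λ x → Σ (Form n) λ ψ → IsL ψ × (φ ≡ (box x ψ ⇒ box x (box x ψ)))

  CK : Form n → Set₁
  CK = CL AxK

  CK4 : Form n → Set₁
  CK4 = CL AxK4

  others : Fin n → List (Fin n)
  others a = filter (λ x → ¬? (x F.≟ a)) (allFinL n)

  chi4 : Fin n → ℕ → Form n
  chi4 a p =
    foldr (λ x acc → and (and (box x botF) (box a (box x botF))) acc)
          (box a (var p)) (others a)
    ⇒ Ck (var p)

-- Every (⋃ₓ Rₓ)⁺-path from a world satisfying the antecedent of χ₄ consists of
-- a-steps only: an x-step (x ≠ a) is excluded at the first step by □ₓ⊥ and
-- afterwards by □ₐ□ₓ⊥, since transitivity of Rₐ keeps every later world an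
-- a-successor of the start.  Hence □ₐp yields Cp on K4 frames.  Without
-- transitivity this fails on the chain u →ₐ v →ₐ w with p true only at v.
-- The second agent b ≠ a is what puts □ₐp, and hence χ₄, into 𝓛_alt𝒞^p.
module Submission where

open import Defs
open import Data.Nat using (ℕ; _≤_; s≤s)
open import Data.Fin using (Fin; zero; _≟_; punchIn)
open import Data.Fin.Properties using (punchInᵢ≢i)
open import Data.List using (List; []; _∷_; foldr; allFin)
open import Data.List.Relation.Unary.All as All using (All; []; _∷_)
open import Data.List.Relation.Unary.All.Properties using (all-filter)
open import Data.List.Membership.Propositional using (_∈_)
open import Data.List.Membership.Propositional.Properties using (∈-filter⁺; ∈-allFin)
open import Data.Product using (_×_; _,_; proj₁; proj₂; ∃-syntax)
open import Data.Empty using (⊥-elim)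
open import Function using (_∘_)
open import Relation.Nullary using (¬_; ¬?)
open import Relation.Nullary.Decidable using (decidable-stable)
open import Relation.Binary.PropositionalEquality using (_≡_; _≢_; refl; sym)

data Chain : Set where
  c₀ c₁ c₂ : Chain

data ChainStep : Chain → Chain → Set where
  c₀c₁ : ChainStep c₀ c₁
  c₁c₂ : ChainStep c₁ c₂

module _ {n : ℕ} where

  sat-botF : (Fr : Frame {n}) (V : ℕ → Frame.W Fr → Set) {u : Frame.W Fr} →
             ¬ sat Fr V (botF {n}) u
  sat-botF Fr V (p , ¬p) = ¬p p

  module _ (Fr : Frame {n}) (V : ℕ → Frame.W Fr → Set) (f : Fin n → Form n) (b : Form n) where

    sat-foldr-and⁻ : ∀ {u} xs → sat Fr V (foldr (λ x acc → and (f x) acc) b xs) u →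
                     All (λ x → sat Fr V (f x) u) xs × sat Fr V b u
    sat-foldr-and⁻ []       sb         = [] , sb
    sat-foldr-and⁻ (x ∷ xs) (sfx , sxs) =
      let sfs , sb = sat-foldr-and⁻ xs sxs in (sfx ∷ sfs) , sb

    sat-foldr-and⁺ : ∀ {u xs} → All (λ x → sat Fr V (f x) u) xs → sat Fr V b u →
                     sat Fr V (foldr (λ x acc → and (f x) acc) b xs) u
    sat-foldr-and⁺ []          sb = sb
    sat-foldr-and⁺ (sfx ∷ sfs) sb = sfx , sat-foldr-and⁺ sfs sb

  Lalt-foldr-and : (f : Fin n → Form n) {b : Form n} {xs : List (Fin n)} →
                   All (Lalt ∘ f) xs → Lalt b → Lalt (foldr (λ x acc → and (f x) acc) b xs)
  Lalt-foldr-and f []         lb = lb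
  Lalt-foldr-and f (lf ∷ lfs) lb = and lf (Lalt-foldr-and f lfs lb)

  botF-Lminus : ∀ {x} → Lminus x (botF {n})
  botF-Lminus = and (var 0) (neg (var 0))

  all-others : (a : Fin n) → All (_≢ a) (others a)
  all-others a = all-filter (λ x → ¬? (x ≟ a)) (allFin n)

  ∈-others : {a x : Fin n} → x ≢ a → x ∈ others a
  ∈-others {a} {x} = ∈-filter⁺ (λ y → ¬? (y ≟ a)) (∈-allFin x)

  ≡-by-exclusion : {P : Fin n → Set} {a x : Fin n} →
                   (∀ {y} → y ≢ a → ¬ P y) → P x → x ≡ a
  ≡-by-exclusion {a = a} {x = x} blocked px =
    decidable-stable (x ≟ a) (λ x≢a → blocked x≢a px)

  module _ (Fr : Frame {n}) where
    open Frame Fr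

    -- Validity of a formula is a negation, so the K4 axiom with the valuation
    -- Rₐ(u, ·) only refutes non-transitivity at u.
    K4-transitive-at : Validates Fr AxK4 → ∀ a u →
                       ¬ ¬ (∀ {v w} → R a u v → R a v w → R a u w)
    K4-transitive-at valid a u ¬trans =
      valid _ (a , var 0 , var 0 , refl) (λ _ → R a u) u
        ((λ _ r → r) , λ □□ → ¬trans λ r r′ → □□ _ r _ r′)

    module _ {a : Fin n} {u : W}
             (trans : ∀ {v w} → R a u v → R a v w → R a u w)
             (only-a₀ : ∀ {x v} → R x u v → x ≡ a)
             (only-a₁ : ∀ {x v w} → R a u v → R x v w → x ≡ a) where

      Rall⇒R : ∀ {v} → Rall Fr u v → R a u v
      Rall⇒R (x , r) with only-a₀ r
      ... | refl = r

      R-Plus⇒R : ∀ {v w} → R a u v → Plus Fr v w → R a u w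
      R-Plus⇒R r (step (x , r′)) with only-a₁ r r′
      ... | refl = trans r r′
      R-Plus⇒R r (cons (x , r′) vw) with only-a₁ r r′
      ... | refl = R-Plus⇒R (trans r r′) vw

      Plus⇒R : ∀ {v} → Plus Fr u v → R a u v
      Plus⇒R (step uv)    = Rall⇒R uv
      Plus⇒R (cons uv vw) = R-Plus⇒R (Rall⇒R uv) vw

  module _ (a : Fin n) (p : ℕ) where

    guard : Fin n → Form n
    guard x = and (box x botF) (box a (box x botF))

    chi4-CK4 : CK4 (chi4 a p)
    chi4-CK4 Fr valid V u (antecedent , ¬Cp) =
      K4-transitive-at Fr valid a u λ trans →
        ¬Cp λ v uv → □ₐp v (Plus⇒R Fr trans only-a₀ only-a₁ uv)
      where
      open Frame Fr
      guards : All (λ x → sat Fr V (guard x) u) (others a) × sat Fr V (box a (var p)) u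
      guards = sat-foldr-and⁻ Fr V guard (box a (var p)) (others a) antecedent
      □ₐp : sat Fr V (box a (var p)) u
      □ₐp = proj₂ guards
      guarded : ∀ {x} → x ≢ a → sat Fr V (guard x) u
      guarded x≢a = All.lookup (proj₁ guards) (∈-others x≢a)
      only-a₀ : ∀ {x v} → R x u v → x ≡ a
      only-a₀ = ≡-by-exclusion λ x≢a r → sat-botF Fr V (proj₁ (guarded x≢a) _ r)
      only-a₁ : ∀ {x v w} → R a u v → R x v w → x ≡ a
      only-a₁ r = ≡-by-exclusion λ x≢a r′ → sat-botF Fr V (proj₂ (guarded x≢a) _ r _ r′)

    chainFrame : Frame
    chainFrame = record { W = Chain ; R = λ x s t → x ≡ a × ChainStep s t }

    chi4-∉CK : ¬ CK (chi4 a p)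
    chi4-∉CK valid = valid chainFrame (λ _ ()) (λ _ s → s ≡ c₁) c₀
      (sat-foldr-and⁺ chainFrame _ guard _ (All.map guard-at-c₀ (all-others a)) □ₐp-at-c₀ ,
       λ Cp → c₂≢c₁ (Cp c₂ (cons (a , refl , c₀c₁) (step (a , refl , c₁c₂)))))
      where
      guard-at-c₀ : ∀ {x} → x ≢ a → sat chainFrame (λ _ s → s ≡ c₁) (guard x) c₀
      guard-at-c₀ x≢a = (λ { _ (x≡a , _) → ⊥-elim (x≢a x≡a) })
                      , (λ { _ _ _ (x≡a , _) → ⊥-elim (x≢a x≡a) })
      □ₐp-at-c₀ : sat chainFrame (λ _ s → s ≡ c₁) (box a (var p)) c₀
      □ₐp-at-c₀ _ (_ , c₀c₁) = refl
      c₂≢c₁ : c₂ ≢ c₁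
      c₂≢c₁ ()

    chi4-LaltCp : ∀ {b} → b ≢ a → LaltCp (chi4 a p)
    chi4-LaltCp {b} b≢a =
      neg (and (alt (Lalt-foldr-and guard (All.map guard-Lalt (all-others a))
                                          (minus b (box a (b≢a ∘ sym) (var p)))))
               (neg (cp (Ck (var p)))))
      where
      guard-Lalt : ∀ {x} → x ≢ a → Lalt (guard x)
      guard-Lalt {x} x≢a = and (minus a (box x x≢a botF-Lminus))
                               (minus x (box a (x≢a ∘ sym) (box x x≢a botF-Lminus)))

another-agent : ∀ {n} → 2 ≤ n → (a : Fin n) → ∃[ b ] b ≢ a
another-agent (s≤s (s≤s _)) a = punchIn a zero , punchInᵢ≢i a zero

mainTheorem13 : (n : ℕ) → 2 ≤ n → (a : Fin n) (p : ℕ) →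
    ((CK4 (chi4 a p) × LaltCp (chi4 a p))
     × ¬ (CK (chi4 a p) × LaltCp (chi4 a p)))
    × ¬ (∀ (φ : Form n) → CK4 φ × LaltCp φ → CK φ × LaltCp φ)
mainTheorem13 n 2≤n a p =
  ((chi4-CK4 a p , inLaltCp) , chi4-∉CK a p ∘ proj₁) ,
  λ inclusion → chi4-∉CK a p (proj₁ (inclusion (chi4 a p) (chi4-CK4 a p , inLaltCp)))
  where
  inLaltCp : LaltCp (chi4 a p)
  inLaltCp = chi4-LaltCp a p (proj₂ (another-agent 2≤n a))
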